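{- Let $t\ge 1$ and $s\ge 3$ be integers with $s>(2^t+1)2^{t-1}$, and let $H_{t,s}=K_t\times C_s$ be the Cartesian product of the complete graph $K_t$ and the cycle $C_s$. Then $H_{t,s}$ is $(t+1)$-regular, its edge-connectivity is $t+1$, and $m(H_{t,s})\le 2^t$.
   Context: The Cartesian product $H_1\times H_2$ of graphs $H_1=(V_1,E_1)$ and $H_2=(V_2,E_2)$ has vertex set $V_1\times V_2$, with $(v_1,v_2)$ adjacent to $(u_1,u_2)$ iff either $v_1=u_1$ and $v_2u_2\in E_2$, or $v_2=u_2$ and $v_1u_1\in E_1$. The symmetric difference of two graphs $G_1=(V,E_1)$, $G_2=(V,E_2)$ on the same vertex set is $(V,E_1\oplus E_2)$, where $E_1\oplus E_2$ is the set of edges in exactly one of $E_1,E_2$. A connectivity code for $H$ is a collection $\mathcal G$ of spanning subgraphs of $H$ such that the symmetric difference of any two distinct members is a connected spanning subgraph of $H$; $m(H)$ is the maximum cardinality of a connectivity code for $H$. -}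

module Defs where

open import Data.Nat.Base using (ℕ; zero; suc; _≡ᵇ_; ⌊_/2⌋; _≤_)
open import Data.Fin.Base using (Fin; toℕ)
open import Data.Fin.Properties using (_≟_)
open import Data.Bool.Base using (Bool; true; false; _∧_; _∨_; not; _xor_; T)
open import Data.List.Base using (List; []; _∷_; length; filterᵇ; cartesianProduct; allFin; lookup)
open import Data.List.Relation.Unary.Unique.Propositional using (Unique)
open import Data.Product.Base using (_×_; _,_; ∃; ∃-syntax; proj₁; proj₂)
open import Relation.Binary.PropositionalEquality using (_≡_; _≢_)
open import Relation.Nullary.Negation using (¬_)
open import Relation.Nullary.Decidable using (⌊_⌋)

-- A (simple, undirected) graph on vertex type V is given by a Boolean
-- adjacency relation; it is a genuine graph when it is symmetric and loopless.
Graph : Set → Set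
Graph V = V → V → Bool

Symmetric : {V : Set} → Graph V → Set
Symmetric {V} G = (u v : V) → G u v ≡ G v u

SpanningSubgraph : {V : Set} → Graph V → Graph V → Set
SpanningSubgraph {V} H G = Symmetric G × ((u v : V) → T (G u v) → T (H u v))

_⊕_ : {V : Set} → Graph V → Graph V → Graph V
(G₁ ⊕ G₂) u v = G₁ u v xor G₂ u v

_∖_ : {V : Set} → Graph V → Graph V → Graph V
(H ∖ F) u v = H u v ∧ not (F u v)

data Walk {V : Set} (G : Graph V) : V → V → Set where
  here : ∀ {u} → Walk G u u
  step : ∀ {u v w} → T (G u v) → Walk G v w → Walk G u w

Connected : {V : Set} → Graph V → Set
Connected {V} G = (u v : V) → Walk G u v

Distinct : {V : Set} → Graph V → Graph V → Set
Distinct G₁ G₂ = ∃[ u ] ∃[ v ] (G₁ u v ≢ G₂ u v)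

-- Counting, relative to a list `vs` enumerating the (finite) vertex set.
degree : {V : Set} → List V → Graph V → V → ℕ
degree vs G u = length (filterᵇ (λ v → G u v) vs)

-- number of edges of a loopless symmetric graph = (# ordered adjacent pairs)/2
edgeCount : {V : Set} → List V → Graph V → ℕ
edgeCount vs G = ⌊ length (filterᵇ (λ p → G (proj₁ p) (proj₂ p)) (cartesianProduct vs vs)) /2⌋

Regular : {V : Set} → List V → Graph V → ℕ → Set
Regular {V} vs G k = (u : V) → degree vs G u ≡ k

EdgeConnectivity : {V : Set} → List V → Graph V → ℕ → Set
EdgeConnectivity {V} vs H k =
  ((F : Graph V) → SpanningSubgraph H F → suc (edgeCount vs F) ≤ k → Connected (H ∖ F))
  × (∃[ F ] (SpanningSubgraph H F × edgeCount vs F ≡ k × ¬ Connected (H ∖ F)))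

-- A connectivity code for H: a finite collection of pairwise distinct
-- spanning subgraphs of H (listed without repetition) such that the symmetric
-- difference of any two distinct members is connected (it is automatically a
-- spanning subgraph of H).
record ConnectivityCode {V : Set} (H : Graph V) : Set₁ where
  field
    members  : List (Graph V)
    spanning : (i : Fin (length members)) → SpanningSubgraph H (lookup members i)
    distinct : (i j : Fin (length members)) → i ≢ j → Distinct (lookup members i) (lookup members j)
    pairwise : (i j : Fin (length members)) → i ≢ j → Connected (lookup members i ⊕ lookup members j)

open ConnectivityCode public

K : (t : ℕ) → Graph (Fin t)
K t a b = not ⌊ a ≟ b ⌋

C : (s : ℕ) → Graph (Fin s)
C s i j = (toℕ j ≡ᵇ suc (toℕ i)) ∨ (toℕ i ≡ᵇ suc (toℕ j))
        ∨ ((toℕ i ≡ᵇ 0) ∧ (suc (toℕ j) ≡ᵇ s)) ∨ ((toℕ j ≡ᵇ 0) ∧ (suc (toℕ i) ≡ᵇ s))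

_□_ : {n₁ n₂ : ℕ} → Graph (Fin n₁) → Graph (Fin n₂) → Graph (Fin n₁ × Fin n₂)
(H₁ □ H₂) (v₁ , v₂) (u₁ , u₂) = (⌊ v₁ ≟ u₁ ⌋ ∧ H₂ v₂ u₂) ∨ (⌊ v₂ ≟ u₂ ⌋ ∧ H₁ v₁ u₁)

H : (t s : ℕ) → Graph (Fin t × Fin s)
H t s = K t □ C s

vertices : (t s : ℕ) → List (Fin t × Fin s)
vertices t s = cartesianProduct (allFin t) (allFin s)

-- Write a vertex of H_{t,s} as (a , i) with a ∈ K_t and i ∈ C_s: column i is a copy of K_t, row a a copy
-- of C_s, and the rungs at i are the row edges (a , i) (a , i + 1). Every vertex has t - 1 neighbours in its
-- column and 2 in its row, and deleting these t + 1 edges isolates it. Deleting at most t edges keeps the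
-- graph connected, because two vertices of a column are joined by t + 1 edge-disjoint paths, and so are a
-- vertex and the next column (one rung per row, plus the long way round its own row). For the code bound,
-- compare members on the t rungs at each column: among 2^t + 1 members two agree there, and since s exceeds
-- the number (2^t + 1) 2^(t-1) of pairs of members, one pair agrees at two columns i < j. Their symmetric
-- difference has no rung at i or at j, so it does not join the columns i + 1, …, j to column i.

module Submission where

open import Defs
open import Data.Nat.Base using (ℕ; suc; _≤_; _<_; _+_; _*_; _^_; _∸_)
open import Data.List.Base using (length)
open import Data.Product.Base using (_×_)

open import Data.Nat as ℕ using (zero; z≤n; s≤s; _≡ᵇ_; ⌊_/2⌋)
import Data.Nat.Properties as ℕ
open import Data.Fin.Base as Fin using (Fin; toℕ; fromℕ; fromℕ<; inject₁; splitAt; funToFin)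
  renaming (zero to fzero; suc to fsuc)
import Data.Fin.Properties as Fin
open import Data.Fin.Properties using (_≟_)
open import Data.Bool.Base using (Bool; true; false; _∧_; _∨_; not; _xor_; T; if_then_else_)
open import Data.Bool.Properties
  using (∧-distribˡ-∨; T-∨; T-∧; ∨-assoc; ∧-zeroʳ; ∧-identityʳ; ∨-identityʳ; ∨-zeroʳ; ∨-comm; xor-same)
open import Data.List.Base using (List; []; _∷_; _++_; map; filterᵇ; cartesianProduct; allFin; upTo; lookup)
import Data.List.Properties as List
open import Data.List.Membership.Propositional using (_∈_)
open import Data.List.Membership.Propositional.Properties
  using (∈-filter⁺; ∈-cartesianProduct⁺; ∈-allFin; ∈-++⁺ˡ; ∈-++⁺ʳ; ∈-map⁺; ∈-upTo⁺)
open import Data.List.Relation.Unary.Any using (index)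
open import Data.List.Relation.Unary.Any.Properties using (lookup-index)
open import Data.Product.Base using (∃₂; ∃-syntax; proj₁; proj₂; _,_; swap)
open import Data.Sum.Base using (_⊎_; inj₁; inj₂; [_,_]′) renaming (swap to ⊎-swap)
open import Data.Empty using (⊥; ⊥-elim)
open import Data.Unit.Base using (tt)
open import Function.Base using (_∘_)
open import Function.Bundles using (Equivalence; Inverse)
open Equivalence using (to; from)
open import Relation.Binary.PropositionalEquality
open import Data.Nat.Tactic.RingSolver using (solve-∀)
open import Algebra.Properties.CommutativeSemigroup ℕ.+-commutativeSemigroup using (interchange)
open import Relation.Nullary using (yes; no; ¬_; T?)
open import Relation.Nullary.Decidable
  using (fromWitnessFalse; toWitnessFalse; fromWitness; ⌊_⌋; isYes≗does; dec-true; dec-false; toWitness)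

private
  variable
    A B : Set
    m n s t : ℕ

≟-refl : (a : Fin n) → ⌊ a ≟ a ⌋ ≡ true
≟-refl a = trans (isYes≗does (a ≟ a)) (dec-true (a ≟ a) refl)

≟-≢ : {a b : Fin n} → a ≢ b → ⌊ a ≟ b ⌋ ≡ false
≟-≢ {a = a} {b} a≢b = trans (isYes≗does (a ≟ b)) (dec-false (a ≟ b) a≢b)

≟-sym : (a b : Fin n) → ⌊ a ≟ b ⌋ ≡ ⌊ b ≟ a ⌋
≟-sym a b with a ≟ b
... | yes refl = sym (≟-refl a)
... | no a≢b = sym (≟-≢ (a≢b ∘ sym))

≟-suc : (a b : Fin n) → ⌊ fsuc a ≟ fsuc b ⌋ ≡ ⌊ a ≟ b ⌋
≟-suc a b with a ≟ b
... | yes _ = refl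
... | no  _ = refl

≡ᵇ⇒≡′ : ∀ {m n} → T (m ≡ᵇ n) → m ≡ n
≡ᵇ⇒≡′ {m} {n} = ℕ.≡ᵇ⇒≡ m n

≡⇒≡ᵇ′ : ∀ {m n} → m ≡ n → T (m ≡ᵇ n)
≡⇒≡ᵇ′ {m} {n} = ℕ.≡⇒≡ᵇ m n

∨-comm-pairs : ∀ a b c d → (a ∨ b ∨ c ∨ d) ≡ (b ∨ a ∨ d ∨ c)
∨-comm-pairs a b c d = trans (sym (∨-assoc a b (c ∨ d)))
                         (trans (cong₂ _∨_ (∨-comm a b) (∨-comm c d)) (∨-assoc b a (d ∨ c)))

T-ext : ∀ {x y} → (T x → T y) → (T y → T x) → x ≡ y
T-ext {false} {false} _ _ = refl
T-ext {false} {true}  _ g = ⊥-elim (g tt)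
T-ext {true}  {false} f _ = ⊥-elim (f tt)
T-ext {true}  {true}  _ _ = refl

-- Finite sums

𝟙 : Bool → ℕ
𝟙 true  = 1
𝟙 false = 0

∑ : List A → (A → ℕ) → ℕ
∑ []       f = 0
∑ (x ∷ xs) f = f x + ∑ xs f

syntax ∑ xs (λ x → e) = ∑[ x ∈ xs ] e

𝟙-∨ : ∀ x y → (T x → T y → ⊥) → 𝟙 (x ∨ y) ≡ 𝟙 x + 𝟙 y
𝟙-∨ true  true  disj = ⊥-elim (disj tt tt)
𝟙-∨ true  false disj = refl
𝟙-∨ false y     disj = refl

𝟙-∧ : ∀ x y → 𝟙 (x ∧ y) ≡ 𝟙 x * 𝟙 y
𝟙-∧ true  y = sym (ℕ.+-identityʳ (𝟙 y))
𝟙-∧ false y = refl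

length-filterᵇ : (p : A → Bool) (xs : List A) → length (filterᵇ p xs) ≡ ∑[ x ∈ xs ] 𝟙 (p x)
length-filterᵇ p []       = refl
length-filterᵇ p (x ∷ xs) with p x
... | true  = cong suc (length-filterᵇ p xs)
... | false = length-filterᵇ p xs

∑-cong : (xs : List A) {f g : A → ℕ} → (∀ x → f x ≡ g x) → ∑ xs f ≡ ∑ xs g
∑-cong []       f≗g = refl
∑-cong (x ∷ xs) f≗g = cong₂ _+_ (f≗g x) (∑-cong xs f≗g)

∑-zero : (xs : List A) → ∑[ x ∈ xs ] 0 ≡ 0
∑-zero []       = refl
∑-zero (x ∷ xs) = ∑-zero xs

∑-++ : (xs ys : List A) (f : A → ℕ) → ∑ (xs ++ ys) f ≡ ∑ xs f + ∑ ys f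
∑-++ []       ys f = refl
∑-++ (x ∷ xs) ys f = trans (cong (f x +_) (∑-++ xs ys f)) (sym (ℕ.+-assoc (f x) _ _))

∑-map : (g : A → B) (xs : List A) (f : B → ℕ) → ∑ (map g xs) f ≡ ∑[ x ∈ xs ] f (g x)
∑-map g []       f = refl
∑-map g (x ∷ xs) f = cong (f (g x) +_) (∑-map g xs f)

∑-+ : (xs : List A) (f g : A → ℕ) → ∑[ x ∈ xs ] (f x + g x) ≡ ∑ xs f + ∑ xs g
∑-+ []       f g = refl
∑-+ (x ∷ xs) f g = trans (cong (f x + g x +_) (∑-+ xs f g)) (interchange (f x) (g x) (∑ xs f) (∑ xs g))

∑-*ˡ : (xs : List A) (c : ℕ) (f : A → ℕ) → ∑[ x ∈ xs ] (c * f x) ≡ c * ∑ xs f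
∑-*ˡ []       c f = sym (ℕ.*-zeroʳ c)
∑-*ˡ (x ∷ xs) c f = trans (cong (c * f x +_) (∑-*ˡ xs c f)) (sym (ℕ.*-distribˡ-+ c (f x) _))

∑-swap : (xs : List A) (ys : List B) (f : A → B → ℕ) →
         ∑[ x ∈ xs ] ∑[ y ∈ ys ] f x y ≡ ∑[ y ∈ ys ] ∑[ x ∈ xs ] f x y
∑-swap []       ys f = sym (∑-zero ys)
∑-swap (x ∷ xs) ys f =
  trans (cong (∑ ys (f x) +_) (∑-swap xs ys f)) (sym (∑-+ ys (f x) (λ y → ∑[ x′ ∈ xs ] f x′ y)))

∑-cartesianProduct : (xs : List A) (ys : List B) (f : A × B → ℕ) →
                     ∑ (cartesianProduct xs ys) f ≡ ∑[ x ∈ xs ] ∑[ y ∈ ys ] f (x , y)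
∑-cartesianProduct []       ys f = refl
∑-cartesianProduct (x ∷ xs) ys f =
  trans (∑-++ (map (x ,_) ys) _ f) (cong₂ _+_ (∑-map (x ,_) ys f) (∑-cartesianProduct xs ys f))

∑-allFin-suc : (f : Fin (suc n) → ℕ) → ∑ (allFin (suc n)) f ≡ f fzero + ∑[ a ∈ allFin n ] f (fsuc a)
∑-allFin-suc {n} f =
  cong (f fzero +_) (trans (cong (λ xs → ∑ xs f) (sym (List.map-tabulate (λ a → a) fsuc))) (∑-map fsuc (allFin n) f))

∑-allFin-pick : (b : Fin n) (f : Fin n → ℕ) → ∑[ a ∈ allFin n ] (𝟙 ⌊ a ≟ b ⌋ * f a) ≡ f b
∑-allFin-pick {suc n} fzero f = begin
  ∑[ a ∈ allFin (suc n) ] (𝟙 ⌊ a ≟ fzero ⌋ * f a)  ≡⟨ ∑-allFin-suc (λ a → 𝟙 ⌊ a ≟ fzero ⌋ * f a) ⟩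
  1 * f fzero + ∑[ a ∈ allFin n ] 0                  ≡⟨ cong₂ _+_ (ℕ.*-identityˡ (f fzero)) (∑-zero (allFin n)) ⟩
  f fzero + 0                                        ≡⟨ ℕ.+-identityʳ (f fzero) ⟩
  f fzero                                            ∎
  where open ≡-Reasoning
∑-allFin-pick {suc n} (fsuc b) f = begin
  ∑[ a ∈ allFin (suc n) ] (𝟙 ⌊ a ≟ fsuc b ⌋ * f a)                 ≡⟨ ∑-allFin-suc (λ a → 𝟙 ⌊ a ≟ fsuc b ⌋ * f a) ⟩
  ∑[ a ∈ allFin n ] (𝟙 ⌊ fsuc a ≟ fsuc b ⌋ * f (fsuc a))
    ≡⟨ ∑-cong (allFin n) (λ a → cong (λ x → 𝟙 x * f (fsuc a)) (≟-suc a b)) ⟩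
  ∑[ a ∈ allFin n ] (𝟙 ⌊ a ≟ b ⌋ * f (fsuc a))                     ≡⟨ ∑-allFin-pick b (f ∘ fsuc) ⟩
  f (fsuc b)                                                        ∎
  where open ≡-Reasoning

∑-allFin-point : (b : Fin n) → ∑[ a ∈ allFin n ] 𝟙 ⌊ a ≟ b ⌋ ≡ 1
∑-allFin-point b = trans (∑-cong (allFin _) (λ a → sym (ℕ.*-identityʳ (𝟙 ⌊ a ≟ b ⌋)))) (∑-allFin-pick b (λ _ → 1))

∑-const : (xs : List A) (c : ℕ) → ∑[ x ∈ xs ] c ≡ length xs * c
∑-const []       c = refl
∑-const (x ∷ xs) c = cong (c +_) (∑-const xs c)

-- Walks and edge-disjoint routes

pigeonhole-∈ : (ys : List A) (f : Fin m → A) → (∀ k → f k ∈ ys) → length ys < m →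
               ∃₂ λ i j → i Fin.< j × f i ≡ f j
pigeonhole-∈ ys f f∈ys len<m with Fin.pigeonhole len<m (λ k → index (f∈ys k))
... | i , j , i<j , same-index =
  i , j , i<j , trans (lookup-index (f∈ys i)) (trans (cong (lookup ys) same-index) (sym (lookup-index (f∈ys j))))

first-or-all : {P : Fin n → Set} → (∀ r → A ⊎ P r) → A ⊎ (∀ r → P r)
first-or-all {zero}  f = inj₂ (λ ())
first-or-all {suc n} {P = P} f with f fzero | first-or-all {P = P ∘ fsuc} (f ∘ fsuc)
... | inj₁ a  | _        = inj₁ a
... | inj₂ p₀ | inj₁ a   = inj₁ a
... | inj₂ p₀ | inj₂ ps  = inj₂ λ { fzero → p₀ ; (fsuc r) → ps r }

_++ʷ_ : {V : Set} {G : Graph V} {u v w : V} → Walk G u v → Walk G v w → Walk G u w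
here       ++ʷ q = q
step uv p  ++ʷ q = step uv (p ++ʷ q)

infixr 5 _++ʷ_

reverseʷ : {V : Set} {G : Graph V} → (∀ u v → T (G u v) → T (G v u)) → {u v : V} → Walk G u v → Walk G v u
reverseʷ G-sym here               = here
reverseʷ G-sym (step {u} {v} e p) = reverseʷ G-sym p ++ʷ step (G-sym u v e) here

walk-preserves : {V : Set} {G : Graph V} (P : V → Set) → (∀ u v → P u → T (G u v) → P v) →
                 {u v : V} → Walk G u v → P u → P v
walk-preserves P closed here       pu = pu
walk-preserves P closed (step e p) pu = walk-preserves P closed p (closed _ _ pu e)

orderedPairs : {V : Set} → List V → Graph V → List (V × V)
orderedPairs vs G = filterᵇ (λ p → G (proj₁ p) (proj₂ p)) (cartesianProduct vs vs)

-- Route r of an edge-disjoint family uses the edges labelled r in both orientations; it is blocked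
-- when one of them lies in F.
Blocked : {V : Set} → Graph V → (V × V → Fin n) → Fin n → Set
Blocked F label r = ∃[ e ] T (F (proj₁ e) (proj₂ e)) × label e ≡ r × label (swap e) ≡ r

module _ {V : Set} {vs : List V} (vs-complete : ∀ x → x ∈ vs)
         {F : Graph V} (F-sym : Symmetric F) (F-irrefl : ∀ x → ¬ T (F x x)) where

  ∈-orderedPairs : ∀ {x y} → T (F x y) → (x , y) ∈ orderedPairs vs F
  ∈-orderedPairs {x} {y} =
    ∈-filter⁺ (λ p → T? (F (proj₁ p) (proj₂ p))) (∈-cartesianProduct⁺ (vs-complete x) (vs-complete y))

  -- The two orientations of n edges carrying pairwise distinct labels are 2n distinct ordered pairs.
  not-all-blocked : (label : V × V → Fin n) → length (orderedPairs vs F) < n + n →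
                    ¬ (∀ r → Blocked F label r)
  not-all-blocked {n} label few blocked =
    let i , j , i<j , same = pigeonhole-∈ (orderedPairs vs F) (oriented ∘ splitAt n) oriented∈ few
    in Fin.<-irrefl (splitAt-injective (oriented-injective same)) i<j
    where
    edge : Fin n → V × V
    edge r = proj₁ (blocked r)

    edge∈F : ∀ r → T (F (proj₁ (edge r)) (proj₂ (edge r)))
    edge∈F r = proj₁ (proj₂ (blocked r))

    label-edge : ∀ r → label (edge r) ≡ r
    label-edge r = proj₁ (proj₂ (proj₂ (blocked r)))

    label-swap-edge : ∀ r → label (swap (edge r)) ≡ r
    label-swap-edge r = proj₂ (proj₂ (proj₂ (blocked r)))

    oriented : Fin n ⊎ Fin n → V × V
    oriented = [ edge , swap ∘ edge ]′

    oriented∈ : ∀ k → oriented (splitAt n k) ∈ orderedPairs vs F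
    oriented∈ k with splitAt n k
    ... | inj₁ r = ∈-orderedPairs (edge∈F r)
    ... | inj₂ r = ∈-orderedPairs (subst T (F-sym _ _) (edge∈F r))

    not-loop : ∀ r → edge r ≢ swap (edge r)
    not-loop r eq = F-irrefl _ (subst (λ y → T (F (proj₁ (edge r)) y)) (sym (cong proj₁ eq)) (edge∈F r))

    oriented-injective : ∀ {x y} → oriented x ≡ oriented y → x ≡ y
    oriented-injective {inj₁ r} {inj₁ r′} eq
      with refl ← trans (sym (label-edge r)) (trans (cong label eq) (label-edge r′)) = refl
    oriented-injective {inj₁ r} {inj₂ r′} eq
      with refl ← trans (sym (label-edge r)) (trans (cong label eq) (label-swap-edge r′)) = ⊥-elim (not-loop r eq)
    oriented-injective {inj₂ r} {inj₁ r′} eq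
      with refl ← trans (sym (label-swap-edge r)) (trans (cong label eq) (label-edge r′)) = ⊥-elim (not-loop r (sym eq))
    oriented-injective {inj₂ r} {inj₂ r′} eq
      with refl ← trans (sym (label-swap-edge r)) (trans (cong label eq) (label-swap-edge r′)) = refl

    splitAt-injective : ∀ {k k′} → splitAt n k ≡ splitAt n k′ → k ≡ k′
    splitAt-injective {k} {k′} eq =
      trans (sym (Fin.join-splitAt n n k)) (trans (cong (Fin.join n n) eq) (Fin.join-splitAt n n k′))

-- The graph H_{t,s}

C-sym : (i j : Fin s) → C s i j ≡ C s j i
C-sym {s} i j = ∨-comm-pairs (toℕ j ≡ᵇ suc (toℕ i)) (toℕ i ≡ᵇ suc (toℕ j))
                  ((toℕ i ≡ᵇ 0) ∧ (suc (toℕ j) ≡ᵇ s)) ((toℕ j ≡ᵇ 0) ∧ (suc (toℕ i) ≡ᵇ s))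

C-cases : (i j : Fin s) → T (C s i j) →
          toℕ j ≡ suc (toℕ i) ⊎ toℕ i ≡ suc (toℕ j) ⊎ (toℕ i ≡ 0 × suc (toℕ j) ≡ s) ⊎ (toℕ j ≡ 0 × suc (toℕ i) ≡ s)
C-cases {s} i j c with to (T-∨ {toℕ j ≡ᵇ suc (toℕ i)}) c
... | inj₁ up = inj₁ (≡ᵇ⇒≡′ up)
... | inj₂ c′ with to (T-∨ {toℕ i ≡ᵇ suc (toℕ j)}) c′
...   | inj₁ down = inj₂ (inj₁ (≡ᵇ⇒≡′ down))
...   | inj₂ c″ with to (T-∨ {(toℕ i ≡ᵇ 0) ∧ (suc (toℕ j) ≡ᵇ s)}) c″
...     | inj₁ wrap = let i≡0 , j≡s = to (T-∧ {toℕ i ≡ᵇ 0}) wrap in inj₂ (inj₂ (inj₁ (≡ᵇ⇒≡′ i≡0 , ≡ᵇ⇒≡′ j≡s)))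
...     | inj₂ wrap = let j≡0 , i≡s = to (T-∧ {toℕ j ≡ᵇ 0}) wrap in inj₂ (inj₂ (inj₂ (≡ᵇ⇒≡′ j≡0 , ≡ᵇ⇒≡′ i≡s)))

C-step : (i j : Fin s) → toℕ j ≡ suc (toℕ i) → T (C s i j)
C-step i j up = from T-∨ (inj₁ (≡⇒≡ᵇ′ up))

C-wrap : (i j : Fin s) → toℕ j ≡ 0 → suc (toℕ i) ≡ s → T (C s i j)
C-wrap {s} i j j≡0 i≡s =
  from (T-∨ {toℕ j ≡ᵇ suc (toℕ i)}) (inj₂ (from (T-∨ {toℕ i ≡ᵇ suc (toℕ j)}) (inj₂
    (from (T-∨ {(toℕ i ≡ᵇ 0) ∧ (suc (toℕ j) ≡ᵇ s)}) (inj₂ (from T-∧ (≡⇒≡ᵇ′ j≡0 , ≡⇒≡ᵇ′ i≡s)))))))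

C-irrefl : 2 ≤ s → (i : Fin s) → ¬ T (C s i i)
C-irrefl 2≤s i c with C-cases i i c
... | inj₁ up                      = ℕ.1+n≢n (sym up)
... | inj₂ (inj₁ down)             = ℕ.1+n≢n (sym down)
... | inj₂ (inj₂ (inj₁ (i≡0 , i≡s))) = ℕ.<-irrefl (trans (cong suc (sym i≡0)) i≡s) 2≤s
... | inj₂ (inj₂ (inj₂ (i≡0 , i≡s))) = ℕ.<-irrefl (trans (cong suc (sym i≡0)) i≡s) 2≤s

next : Fin s → Fin s
next {suc n} i with suc (toℕ i) ℕ.<? suc n
... | yes i+1<s = fromℕ< i+1<s
... | no  _     = fzero

prev : Fin s → Fin s
prev {suc n} fzero    = fromℕ n
prev {suc n} (fsuc i) = inject₁ i

next-spec : (i : Fin s) → (suc (toℕ i) < s × toℕ (next i) ≡ suc (toℕ i)) ⊎ (suc (toℕ i) ≡ s × toℕ (next i) ≡ 0)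
next-spec {suc n} i with suc (toℕ i) ℕ.<? suc n
... | yes i+1<s = inj₁ (i+1<s , Fin.toℕ-fromℕ< i+1<s)
... | no  i+1≮s = inj₂ (ℕ.≤-antisym (Fin.toℕ<n i) (ℕ.≮⇒≥ i+1≮s) , refl)

prev-spec : (i : Fin s) → toℕ i ≡ suc (toℕ (prev i)) ⊎ (toℕ i ≡ 0 × suc (toℕ (prev i)) ≡ s)
prev-spec {suc n} fzero    = inj₂ (refl , cong suc (Fin.toℕ-fromℕ n))
prev-spec {suc n} (fsuc i) = inj₁ (cong suc (sym (Fin.toℕ-inject₁ i)))

toℕ-next : (i : Fin s) → suc (toℕ i) < s → toℕ (next i) ≡ suc (toℕ i)
toℕ-next i i+1<s with next-spec i
... | inj₁ (_ , up)     = up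
... | inj₂ (i+1≡s , _) = ⊥-elim (ℕ.<-irrefl i+1≡s i+1<s)

C-next : (i : Fin s) → T (C s i (next i))
C-next i with next-spec i
... | inj₁ (_ , up)      = C-step i (next i) up
... | inj₂ (i≡s , next≡0) = C-wrap i (next i) next≡0 i≡s

C-prev : (i : Fin s) → T (C s i (prev i))
C-prev i with prev-spec i
... | inj₁ down             = subst T (C-sym (prev i) i) (C-step (prev i) i down)
... | inj₂ (i≡0 , prev≡s) = subst T (C-sym (prev i) i) (C-wrap (prev i) i i≡0 prev≡s)

C-neighbour : (i j : Fin s) → T (C s i j) → j ≡ next i ⊎ j ≡ prev i
C-neighbour {s} i j c with C-cases i j c | next-spec i | prev-spec i
... | inj₁ up | inj₁ (_ , next-up) | _ = inj₁ (Fin.toℕ-injective (trans up (sym next-up)))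
... | inj₁ up | inj₂ (i≡s , _) | _ = ⊥-elim (ℕ.<-irrefl (trans up i≡s) (Fin.toℕ<n j))
... | inj₂ (inj₁ down) | _ | inj₁ prev-down = inj₂ (Fin.toℕ-injective (ℕ.suc-injective (trans (sym down) prev-down)))
... | inj₂ (inj₁ down) | _ | inj₂ (i≡0 , _) = ⊥-elim (ℕ.0≢1+n (trans (sym i≡0) down))
... | inj₂ (inj₂ (inj₁ (i≡0 , _))) | _ | inj₁ prev-down = ⊥-elim (ℕ.0≢1+n (trans (sym i≡0) prev-down))
... | inj₂ (inj₂ (inj₁ (_ , j≡s))) | _ | inj₂ (_ , prev≡s) =
  inj₂ (Fin.toℕ-injective (ℕ.suc-injective (trans j≡s (sym prev≡s))))
... | inj₂ (inj₂ (inj₂ (_ , i≡s))) | inj₁ (i<s , _) | _ = ⊥-elim (ℕ.<-irrefl i≡s i<s)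
... | inj₂ (inj₂ (inj₂ (j≡0 , _))) | inj₂ (_ , next≡0) | _ = inj₁ (Fin.toℕ-injective (trans j≡0 (sym next≡0)))

next≢ : 2 ≤ s → (i : Fin s) → next i ≢ i
next≢ 2≤s i next≡i = C-irrefl 2≤s i (subst (T ∘ C _ i) next≡i (C-next i))

prev≢ : 2 ≤ s → (i : Fin s) → prev i ≢ i
prev≢ 2≤s i prev≡i = C-irrefl 2≤s i (subst (T ∘ C _ i) prev≡i (C-prev i))

next≢prev : 3 ≤ s → (i : Fin s) → next i ≢ prev i
next≢prev {s} 3≤s i eq with cong toℕ eq | next-spec i | prev-spec i
... | N≡P | inj₁ (_ , next-up) | inj₁ prev-down =
  ℕ.<-irrefl (trans (sym N≡P) (trans next-up (cong suc prev-down))) (ℕ.m<n⇒m<1+n (ℕ.n<1+n _))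
... | N≡P | inj₁ (_ , next-up) | inj₂ (i≡0 , prev≡s) =
  ℕ.<-irrefl (trans (cong suc (trans (sym (trans next-up (cong suc i≡0))) N≡P)) prev≡s) 3≤s
... | N≡P | inj₂ (i≡s , next≡0) | inj₁ prev-down =
  ℕ.<-irrefl (trans (cong suc (sym (trans prev-down (cong suc (trans (sym N≡P) next≡0))))) i≡s) 3≤s
... | _ | inj₂ (i≡s , _) | inj₂ (i≡0 , _) =
  ℕ.<-irrefl (trans (cong suc (sym i≡0)) i≡s) (ℕ.≤-trans (s≤s (s≤s z≤n)) 3≤s)

C≡next∨prev : (i j : Fin s) → C s i j ≡ (⌊ j ≟ next i ⌋ ∨ ⌊ j ≟ prev i ⌋)
C≡next∨prev {s} i j = T-ext to-next∨prev from-next∨prev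
  where
  to-next∨prev : T (C s i j) → T (⌊ j ≟ next i ⌋ ∨ ⌊ j ≟ prev i ⌋)
  to-next∨prev c with C-neighbour i j c
  ... | inj₁ j≡next = from (T-∨ {⌊ j ≟ next i ⌋}) (inj₁ (fromWitness j≡next))
  ... | inj₂ j≡prev = from (T-∨ {⌊ j ≟ next i ⌋}) (inj₂ (fromWitness j≡prev))
  from-next∨prev : T (⌊ j ≟ next i ⌋ ∨ ⌊ j ≟ prev i ⌋) → T (C s i j)
  from-next∨prev p with to (T-∨ {⌊ j ≟ next i ⌋}) p
  ... | inj₁ j≡next = subst (T ∘ C s i) (sym (toWitness j≡next)) (C-next i)
  ... | inj₂ j≡prev = subst (T ∘ C s i) (sym (toWitness j≡prev)) (C-prev i)

C-degree : 3 ≤ s → (i : Fin s) → ∑[ j ∈ allFin s ] 𝟙 (C s i j) ≡ 2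
C-degree {s} 3≤s i = begin
  ∑[ j ∈ allFin s ] 𝟙 (C s i j)                                   ≡⟨ ∑-cong (allFin s) split ⟩
  ∑[ j ∈ allFin s ] (𝟙 ⌊ j ≟ next i ⌋ + 𝟙 ⌊ j ≟ prev i ⌋)         ≡⟨ ∑-+ (allFin s) _ _ ⟩
  ∑[ j ∈ allFin s ] 𝟙 ⌊ j ≟ next i ⌋ + ∑[ j ∈ allFin s ] 𝟙 ⌊ j ≟ prev i ⌋
                                                                  ≡⟨ cong₂ _+_ (∑-allFin-point (next i)) (∑-allFin-point (prev i)) ⟩
  2                                                               ∎
  where
  open ≡-Reasoning
  split : ∀ j → 𝟙 (C s i j) ≡ 𝟙 ⌊ j ≟ next i ⌋ + 𝟙 ⌊ j ≟ prev i ⌋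
  split j = trans (cong 𝟙 (C≡next∨prev i j))
    (𝟙-∨ ⌊ j ≟ next i ⌋ ⌊ j ≟ prev i ⌋ (λ p q → next≢prev 3≤s i (trans (sym (toWitness p)) (toWitness q))))

K-sym : (a b : Fin t) → K t a b ≡ K t b a
K-sym a b = cong not (≟-sym a b)

H-sym : (x y : Fin t × Fin s) → H t s x y ≡ H t s y x
H-sym (a , i) (b , j) = cong₂ _∨_ (cong₂ _∧_ (≟-sym a b) (C-sym i j)) (cong₂ _∧_ (≟-sym i j) (K-sym a b))

H-cases : (a b : Fin t) (i j : Fin s) → T (H t s (a , i) (b , j)) → (a ≡ b × T (C s i j)) ⊎ (i ≡ j × a ≢ b)
H-cases a b i j h with to (T-∨ {⌊ a ≟ b ⌋ ∧ C _ i j}) h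
... | inj₁ row    = let a≡b , c = to (T-∧ {⌊ a ≟ b ⌋}) row in inj₁ (toWitness a≡b , c)
... | inj₂ column = let i≡j , k = to (T-∧ {⌊ i ≟ j ⌋}) column in inj₂ (toWitness i≡j , toWitnessFalse k)

H-row : (a : Fin t) (i j : Fin s) → T (C s i j) → T (H t s (a , i) (a , j))
H-row a i j c = from (T-∨ {⌊ a ≟ a ⌋ ∧ C _ i j}) (inj₁ (from (T-∧ {⌊ a ≟ a ⌋}) (fromWitness refl , c)))

H-column : (a b : Fin t) (i : Fin s) → a ≢ b → T (H t s (a , i) (b , i))
H-column a b i a≢b =
  from (T-∨ {⌊ a ≟ b ⌋ ∧ C _ i i}) (inj₂ (from (T-∧ {⌊ i ≟ i ⌋}) (fromWitness refl , fromWitnessFalse a≢b)))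

H-irrefl : 2 ≤ s → (x : Fin t × Fin s) → ¬ T (H t s x x)
H-irrefl 2≤s (a , i) h with H-cases a a i i h
... | inj₁ (_ , c)   = C-irrefl 2≤s i c
... | inj₂ (_ , a≢a) = a≢a refl

H-same-row : (a : Fin t) (i j : Fin s) → H t s (a , i) (a , j) ≡ C s i j
H-same-row a i j rewrite ≟-refl a = trans (cong (C _ i j ∨_) (∧-zeroʳ ⌊ i ≟ j ⌋)) (∨-identityʳ (C _ i j))

H-other-row : {a b : Fin t} (i j : Fin s) → a ≢ b → H t s (a , i) (b , j) ≡ ⌊ i ≟ j ⌋
H-other-row i j a≢b rewrite ≟-≢ a≢b = ∧-identityʳ ⌊ i ≟ j ⌋

H-row-degree : 3 ≤ s → (a b : Fin t) (i : Fin s) → ∑[ j ∈ allFin s ] 𝟙 (H t s (a , i) (b , j)) ≡ 1 + 𝟙 ⌊ b ≟ a ⌋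
H-row-degree {s} 3≤s a b i with b ≟ a
... | yes refl = trans (∑-cong (allFin s) (cong 𝟙 ∘ H-same-row a i)) (C-degree 3≤s i)
... | no b≢a   = trans (∑-cong (allFin s) (λ j → cong 𝟙 (trans (H-other-row i j (b≢a ∘ sym)) (≟-sym i j))))
                       (∑-allFin-point i)

H-degree : 3 ≤ s → (x : Fin t × Fin s) → ∑[ y ∈ vertices t s ] 𝟙 (H t s x y) ≡ t + 1
H-degree {s} {t} 3≤s (a , i) = begin
  ∑[ y ∈ vertices t s ] 𝟙 (H t s (a , i) y)                        ≡⟨ ∑-cartesianProduct (allFin t) (allFin s) _ ⟩
  ∑[ b ∈ allFin t ] ∑[ j ∈ allFin s ] 𝟙 (H t s (a , i) (b , j))     ≡⟨ ∑-cong (allFin t) (λ b → H-row-degree 3≤s a b i) ⟩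
  ∑[ b ∈ allFin t ] (1 + 𝟙 ⌊ b ≟ a ⌋)                                ≡⟨ ∑-+ (allFin t) _ _ ⟩
  ∑[ b ∈ allFin t ] 1 + ∑[ b ∈ allFin t ] 𝟙 ⌊ b ≟ a ⌋                ≡⟨ cong₂ _+_ column-size (∑-allFin-point a) ⟩
  t + 1                                                              ∎
  where
  open ≡-Reasoning
  column-size : ∑[ b ∈ allFin t ] 1 ≡ t
  column-size = trans (∑-const (allFin t) 1) (trans (cong (_* 1) (List.length-tabulate {n = t} (λ a → a))) (ℕ.*-identityʳ t))

H-regular : 3 ≤ s → Regular (vertices t s) (H t s) (t + 1)
H-regular {s} {t} 3≤s x = trans (length-filterᵇ (H t s x) (vertices t s)) (H-degree 3≤s x)

_≐_ : Fin t × Fin s → Fin t × Fin s → Bool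
(a , i) ≐ (b , j) = ⌊ a ≟ b ⌋ ∧ ⌊ i ≟ j ⌋

≐-refl : (x : Fin t × Fin s) → T (x ≐ x)
≐-refl (a , i) = from (T-∧ {⌊ a ≟ a ⌋}) (fromWitness refl , fromWitness refl)

≐⇒≡ : (x y : Fin t × Fin s) → T (x ≐ y) → x ≡ y
≐⇒≡ (a , i) (b , j) p = let a≡b , i≡j = to (T-∧ {⌊ a ≟ b ⌋}) p in cong₂ _,_ (toWitness a≡b) (toWitness i≡j)

∑-vertices-pick : (z : Fin t × Fin s) (f : Fin t × Fin s → ℕ) → ∑[ x ∈ vertices t s ] (𝟙 (x ≐ z) * f x) ≡ f z
∑-vertices-pick {t} {s} (c , k) f = begin
  ∑[ x ∈ vertices t s ] (𝟙 (x ≐ (c , k)) * f x)                          ≡⟨ ∑-cartesianProduct (allFin t) (allFin s) _ ⟩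
  ∑[ a ∈ allFin t ] ∑[ i ∈ allFin s ] (𝟙 (⌊ a ≟ c ⌋ ∧ ⌊ i ≟ k ⌋) * f (a , i))
    ≡⟨ ∑-cong (allFin t) (λ a → trans (∑-cong (allFin s) (λ i → factor a i)) (∑-*ˡ (allFin s) (𝟙 ⌊ a ≟ c ⌋) _)) ⟩
  ∑[ a ∈ allFin t ] (𝟙 ⌊ a ≟ c ⌋ * ∑[ i ∈ allFin s ] (𝟙 ⌊ i ≟ k ⌋ * f (a , i)))
    ≡⟨ ∑-cong (allFin t) (λ a → cong (𝟙 ⌊ a ≟ c ⌋ *_) (∑-allFin-pick k (λ i → f (a , i)))) ⟩
  ∑[ a ∈ allFin t ] (𝟙 ⌊ a ≟ c ⌋ * f (a , k))                            ≡⟨ ∑-allFin-pick c (λ a → f (a , k)) ⟩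
  f (c , k)                                                                ∎
  where
  open ≡-Reasoning
  factor : ∀ a i → 𝟙 (⌊ a ≟ c ⌋ ∧ ⌊ i ≟ k ⌋) * f (a , i) ≡ 𝟙 ⌊ a ≟ c ⌋ * (𝟙 ⌊ i ≟ k ⌋ * f (a , i))
  factor a i = trans (cong (_* f (a , i)) (𝟙-∧ ⌊ a ≟ c ⌋ ⌊ i ≟ k ⌋)) (ℕ.*-assoc (𝟙 ⌊ a ≟ c ⌋) _ _)

star : Fin t × Fin s → Graph (Fin t × Fin s)
star {t} {s} z x y = H t s x y ∧ (x ≐ z ∨ y ≐ z)

star-spanning : (z : Fin t × Fin s) → SpanningSubgraph (H t s) (star z)
star-spanning {t} {s} z = (λ x y → cong₂ _∧_ (H-sym x y) (∨-comm (x ≐ z) (y ≐ z)))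
                        , (λ x y p → proj₁ (to (T-∧ {H t s x y}) p))

star-orderedPairs : 3 ≤ s → (z : Fin t × Fin s) → length (orderedPairs (vertices t s) (star z)) ≡ (t + 1) + (t + 1)
star-orderedPairs {s} {t} 3≤s z = begin
  length (orderedPairs vs (star z))                                ≡⟨ length-filterᵇ _ (cartesianProduct vs vs) ⟩
  ∑[ p ∈ cartesianProduct vs vs ] 𝟙 (star z (proj₁ p) (proj₂ p))  ≡⟨ ∑-cartesianProduct vs vs _ ⟩
  ∑[ x ∈ vs ] ∑[ y ∈ vs ] 𝟙 (star z x y)                           ≡⟨ ∑-cong vs (λ x → trans (∑-cong vs (split x)) (∑-+ vs _ _)) ⟩
  ∑[ x ∈ vs ] (∑[ y ∈ vs ] leaving x y + ∑[ y ∈ vs ] leaving y x)  ≡⟨ ∑-+ vs _ _ ⟩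
  ∑[ x ∈ vs ] ∑[ y ∈ vs ] leaving x y + ∑[ x ∈ vs ] ∑[ y ∈ vs ] leaving y x
                                                                   ≡⟨ cong (∑[ x ∈ vs ] ∑[ y ∈ vs ] leaving x y +_) (∑-swap vs vs (λ x y → leaving y x)) ⟩
  ∑[ x ∈ vs ] ∑[ y ∈ vs ] leaving x y + ∑[ y ∈ vs ] ∑[ x ∈ vs ] leaving y x
                                                                   ≡⟨ cong₂ _+_ all-leaving all-leaving ⟩
  (t + 1) + (t + 1)                                                ∎
  where
  open ≡-Reasoning
  vs = vertices t s

  leaving : Fin t × Fin s → Fin t × Fin s → ℕ
  leaving x y = 𝟙 (H t s x y ∧ x ≐ z)

  split : ∀ x y → 𝟙 (star z x y) ≡ leaving x y + leaving y x
  split x y = trans (cong 𝟙 (∧-distribˡ-∨ (H t s x y) (x ≐ z) (y ≐ z)))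
    (trans (𝟙-∨ _ _ loop) (cong (λ b → leaving x y + 𝟙 (b ∧ y ≐ z)) (H-sym x y)))
    where
    loop : T (H t s x y ∧ x ≐ z) → T (H t s x y ∧ y ≐ z) → ⊥
    loop p q = let h , x≐z = to (T-∧ {H t s x y}) p ; _ , y≐z = to (T-∧ {H t s x y}) q in
      H-irrefl (ℕ.<⇒≤ 3≤s) y (subst (λ x → T (H t s x y)) (trans (≐⇒≡ x z x≐z) (sym (≐⇒≡ y z y≐z))) h)

  all-leaving : ∑[ x ∈ vs ] ∑[ y ∈ vs ] leaving x y ≡ t + 1
  all-leaving = begin
    ∑[ x ∈ vs ] ∑[ y ∈ vs ] leaving x y             ≡⟨ ∑-cong vs (λ x → trans (∑-cong vs (factor x)) (∑-*ˡ vs (𝟙 (x ≐ z)) _)) ⟩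
    ∑[ x ∈ vs ] (𝟙 (x ≐ z) * ∑[ y ∈ vs ] 𝟙 (H t s x y)) ≡⟨ ∑-cong vs (λ x → cong (𝟙 (x ≐ z) *_) (H-degree 3≤s x)) ⟩
    ∑[ x ∈ vs ] (𝟙 (x ≐ z) * (t + 1))               ≡⟨ ∑-vertices-pick z (λ _ → t + 1) ⟩
    t + 1                                             ∎
    where
    factor : ∀ x y → leaving x y ≡ 𝟙 (x ≐ z) * 𝟙 (H t s x y)
    factor x y = trans (𝟙-∧ (H t s x y) (x ≐ z)) (ℕ.*-comm (𝟙 (H t s x y)) _)

star-edgeCount : 3 ≤ s → (z : Fin t × Fin s) → edgeCount (vertices t s) (star z) ≡ t + 1
star-edgeCount 3≤s z = trans (cong ⌊_/2⌋ (star-orderedPairs 3≤s z)) (sym (ℕ.n≡⌊n+n/2⌋ _))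

star-isolates : (z w : Fin t × Fin s) → ¬ T ((H t s ∖ star z) z w)
star-isolates {t} {s} z w p with H t s z w | z ≐ z | ≐-refl z
... | true  | true | _ = p
... | false | _    | _ = p

star-disconnects : 2 ≤ s → (z : Fin t × Fin s) → ¬ Connected (H t s ∖ star z)
star-disconnects 2≤s (c , k) connected = stuck (connected (c , k) (c , next k)) (λ eq → next≢ 2≤s k (sym (cong proj₂ eq)))
  where
  stuck : ∀ {w} → Walk (H _ _ ∖ star (c , k)) (c , k) w → (c , k) ≢ w → ⊥
  stuck here       z≢z = z≢z refl
  stuck (step e _) _   = star-isolates (c , k) _ e

-- Edge connectivity

vertices-complete : (x : Fin t × Fin s) → x ∈ vertices t s
vertices-complete (a , i) = ∈-cartesianProduct⁺ (∈-allFin a) (∈-allFin i)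

touches : Fin s → Fin s → Fin s → Bool
touches c₁ c₂ k = ⌊ c₁ ≟ k ⌋ ∨ ⌊ c₂ ≟ k ⌋

touches-true : {c₁ c₂ k : Fin s} → c₁ ≡ k ⊎ c₂ ≡ k → touches c₁ c₂ k ≡ true
touches-true {c₁ = c₁} {c₂} (inj₁ refl) = cong (_∨ ⌊ c₂ ≟ c₁ ⌋) (≟-refl c₁)
touches-true {c₁ = c₁} {c₂} (inj₂ refl) = trans (cong (⌊ c₁ ≟ c₂ ⌋ ∨_) (≟-refl c₂)) (∨-zeroʳ _)

touches-false : {c₁ c₂ k : Fin s} → c₁ ≢ k → c₂ ≢ k → touches c₁ c₂ k ≡ false
touches-false c₁≢k c₂≢k rewrite ≟-≢ c₁≢k | ≟-≢ c₂≢k = refl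

both-≟-false : {c₁ c₂ k₁ k₂ : Fin s} → ¬ (c₁ ≡ k₁ × c₂ ≡ k₂) → (⌊ c₁ ≟ k₁ ⌋ ∧ ⌊ c₂ ≟ k₂ ⌋) ≡ false
both-≟-false {c₁ = c₁} {c₂} {k₁} {k₂} ¬both with c₁ ≟ k₁ | c₂ ≟ k₂
... | yes c₁≡k₁ | yes c₂≡k₂ = ⊥-elim (¬both (c₁≡k₁ , c₂≡k₂))
... | yes _     | no _      = refl
... | no _      | _         = refl

module FewEdgesDeleted {t s : ℕ} (3≤s : 3 ≤ s) {F : Graph (Fin t × Fin s)} (F-spanning : SpanningSubgraph (H t s) F)
                       (few : length (orderedPairs (vertices t s) F) < suc t + suc t) where

  V : Set
  V = Fin t × Fin s

  G : Graph V
  G = H t s ∖ F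

  2≤s : 2 ≤ s
  2≤s = ℕ.<⇒≤ 3≤s

  G-sym : ∀ x y → T (G x y) → T (G y x)
  G-sym x y rewrite H-sym x y | proj₁ F-spanning x y = λ g → g

  Route : (V × V → Fin (suc t)) → Fin (suc t) → V → V → Set
  Route label r x y = Walk G x y ⊎ Blocked F label r

  edge-route : ∀ {label r} x y → T (H t s x y) → label (x , y) ≡ r → label (y , x) ≡ r → Route label r x y
  edge-route x y h xy yx with F x y in Fxy
  ... | true  = inj₂ ((x , y) , subst T (sym Fxy) tt , xy , yx)
  ... | false = inj₁ (step (from T-∧ (h , subst (T ∘ not) (sym Fxy) tt)) here)

  _⟫_ : ∀ {label r x y z} → Route label r x y → Route label r y z → Route label r x z
  inj₁ p ⟫ inj₁ q = inj₁ (p ++ʷ q)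
  inj₁ p ⟫ inj₂ b = inj₂ b
  inj₂ b ⟫ _      = inj₂ b

  infixr 5 _⟫_

  survivor : (label : V × V → Fin (suc t)) {A : Set} → (∀ r → A ⊎ Blocked F label r) → A
  survivor label routes with first-or-all routes
  ... | inj₁ success = success
  ... | inj₂ blocked = ⊥-elim (not-all-blocked vertices-complete (proj₁ F-spanning)
                                 (λ x f → H-irrefl 2≤s x (proj₂ F-spanning x x f)) label few blocked)

  -- Routes from (a , i) to (b , i): the direct edge, a path through (c , i) for every other c, and
  -- detours through the neighbouring columns next i and prev i; the label of an edge names its route.
  module ColumnRoutes (a b : Fin t) (i : Fin s) (a≢b : a ≢ b) where

    outside : Fin t → Bool
    outside r = not (⌊ r ≟ a ⌋ ∨ ⌊ r ≟ b ⌋)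

    inner : Fin t → Fin t → Fin (suc t)
    inner r₁ r₂ = if outside r₁ then fsuc r₁ else if outside r₂ then fsuc r₂ else fzero

    label : V × V → Fin (suc t)
    label ((r₁ , c₁) , (r₂ , c₂)) =
      if touches c₁ c₂ (next i) then fsuc a else if touches c₁ c₂ (prev i) then fsuc b else inner r₁ r₂

    outside-a : outside a ≡ false
    outside-a rewrite ≟-refl a = refl

    outside-b : outside b ≡ false
    outside-b rewrite ≟-refl b = cong not (∨-zeroʳ ⌊ b ≟ a ⌋)

    outside-c : {c : Fin t} → c ≢ a → c ≢ b → outside c ≡ true
    outside-c c≢a c≢b rewrite ≟-≢ c≢a | ≟-≢ c≢b = refl

    label-next : ∀ {r₁ c₁ r₂ c₂} → c₁ ≡ next i ⊎ c₂ ≡ next i → label ((r₁ , c₁) , (r₂ , c₂)) ≡ fsuc a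
    label-next touch rewrite touches-true touch = refl

    label-prev : ∀ {r₁ c₁ r₂ c₂} → c₁ ≢ next i → c₂ ≢ next i → c₁ ≡ prev i ⊎ c₂ ≡ prev i →
                 label ((r₁ , c₁) , (r₂ , c₂)) ≡ fsuc b
    label-prev c₁≢ c₂≢ touch rewrite touches-false c₁≢ c₂≢ | touches-true touch = refl

    label-column : ∀ r₁ r₂ → label ((r₁ , i) , (r₂ , i)) ≡ inner r₁ r₂
    label-column r₁ r₂ rewrite touches-false (next≢ 2≤s i ∘ sym) (next≢ 2≤s i ∘ sym)
                             | touches-false (prev≢ 2≤s i ∘ sym) (prev≢ 2≤s i ∘ sym) = refl

    via-next : ∀ x y → T (H t s x y) → proj₂ x ≡ next i ⊎ proj₂ y ≡ next i → Route label (fsuc a) x y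
    via-next (r₁ , c₁) (r₂ , c₂) h touch =
      edge-route _ _ h (label-next {r₁} {c₁} {r₂} touch) (label-next {r₂} {c₂} {r₁} (⊎-swap touch))

    via-prev : ∀ x y → T (H t s x y) → proj₂ x ≢ next i → proj₂ y ≢ next i → proj₂ x ≡ prev i ⊎ proj₂ y ≡ prev i →
               Route label (fsuc b) x y
    via-prev (r₁ , c₁) (r₂ , c₂) h c₁≢ c₂≢ touch =
      edge-route _ _ h (label-prev {r₁} {c₁} {r₂} c₁≢ c₂≢ touch) (label-prev {r₂} {c₂} {r₁} c₂≢ c₁≢ (⊎-swap touch))

    within-column : ∀ {r} r₁ r₂ → r₁ ≢ r₂ → inner r₁ r₂ ≡ r → inner r₂ r₁ ≡ r → Route label r (r₁ , i) (r₂ , i)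
    within-column r₁ r₂ r₁≢r₂ e₁₂ e₂₁ =
      edge-route _ _ (H-column r₁ r₂ i r₁≢r₂) (trans (label-column r₁ r₂) e₁₂) (trans (label-column r₂ r₁) e₂₁)

    i≢next : i ≢ next i
    i≢next = next≢ 2≤s i ∘ sym

    prev≢next : prev i ≢ next i
    prev≢next = next≢prev 3≤s i ∘ sym

    route : ∀ r → Route label r (a , i) (b , i)
    route fzero = within-column a b a≢b direct direct′
      where
      direct : inner a b ≡ fzero
      direct rewrite outside-a | outside-b = refl
      direct′ : inner b a ≡ fzero
      direct′ rewrite outside-a | outside-b = refl
    route (fsuc c) with c ≟ a | c ≟ b
    ... | yes refl | _ =
          via-next (a , i) (a , next i) (H-row a i (next i) (C-next i)) (inj₂ refl)
        ⟫ via-next (a , next i) (b , next i) (H-column a b (next i) a≢b) (inj₁ refl)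
        ⟫ via-next (b , next i) (b , i) (H-row b (next i) i (subst T (C-sym i (next i)) (C-next i))) (inj₁ refl)
    ... | no _ | yes refl =
          via-prev (a , i) (a , prev i) (H-row a i (prev i) (C-prev i)) i≢next prev≢next (inj₂ refl)
        ⟫ via-prev (a , prev i) (b , prev i) (H-column a b (prev i) a≢b) prev≢next prev≢next (inj₁ refl)
        ⟫ via-prev (b , prev i) (b , i) (H-row b (prev i) i (subst T (C-sym i (prev i)) (C-prev i)))
                   prev≢next i≢next (inj₁ refl)
    ... | no c≢a | no c≢b =
          within-column a c (c≢a ∘ sym) ac ca ⟫ within-column c b c≢b cb bc
      where
      ac : inner a c ≡ fsuc c
      ac rewrite outside-a | outside-c c≢a c≢b = refl
      ca : inner c a ≡ fsuc c
      ca rewrite outside-c c≢a c≢b = refl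
      cb : inner c b ≡ fsuc c
      cb rewrite outside-c c≢a c≢b = refl
      bc : inner b c ≡ fsuc c
      bc rewrite outside-b | outside-c c≢a c≢b = refl

  column-walk : (a b : Fin t) (i : Fin s) → Walk G (a , i) (b , i)
  column-walk a b i with a ≟ b
  ... | yes refl = here
  ... | no a≢b   = survivor (ColumnRoutes.label a b i a≢b) (ColumnRoutes.route a b i a≢b)

  RungsLabelled : (V × V → Fin (suc t)) → Fin (suc t) → Fin t → Fin s → Fin s → Set
  RungsLabelled label r a lo hi = ∀ p q → toℕ p ≡ suc (toℕ q) → toℕ lo ≤ toℕ q → toℕ p ≤ toℕ hi →
                                  label ((a , p) , (a , q)) ≡ r × label ((a , q) , (a , p)) ≡ r

  descend : ∀ {label r} a lo d hi → toℕ hi ≡ d + toℕ lo → RungsLabelled label r a lo hi → Route label r (a , hi) (a , lo)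
  descend a lo zero    hi hi≡lo labelled = inj₁ (subst (λ c → Walk G (a , hi) (a , c)) (Fin.toℕ-injective hi≡lo) here)
  descend a lo (suc d) hi hi≡ labelled =
      edge-route _ _ (H-row a hi q (subst T (C-sym q hi) (C-step q hi hi≡q+1)))
                 (proj₁ (labelled hi q hi≡q+1 lo≤q ℕ.≤-refl)) (proj₂ (labelled hi q hi≡q+1 lo≤q ℕ.≤-refl))
    ⟫ descend a lo d q (Fin.toℕ-fromℕ< q<s) (λ p q′ p≡ lo≤q′ p≤q → labelled p q′ p≡ lo≤q′ (ℕ.≤-trans p≤q q≤hi))
    where
    q<s : d + toℕ lo < s
    q<s = ℕ.<-trans (ℕ.n<1+n _) (subst (_< s) hi≡ (Fin.toℕ<n hi))
    q : Fin s
    q = fromℕ< q<s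
    hi≡q+1 : toℕ hi ≡ suc (toℕ q)
    hi≡q+1 = trans hi≡ (cong suc (sym (Fin.toℕ-fromℕ< q<s)))
    lo≤q : toℕ lo ≤ toℕ q
    lo≤q = subst (toℕ lo ≤_) (sym (Fin.toℕ-fromℕ< q<s)) (ℕ.m≤n+m (toℕ lo) d)
    q≤hi : toℕ q ≤ toℕ hi
    q≤hi = subst (toℕ q ≤_) (sym hi≡q+1) (ℕ.n≤1+n (toℕ q))

  -- Routes from (a , x) into column y = x + 1: the rung of every row c, reached inside column x,
  -- and the long way round row a.
  module NextColumnRoutes (a : Fin t) (x y : Fin s) (y≡x+1 : toℕ y ≡ suc (toℕ x)) where

    crosses : Fin s → Fin s → Bool
    crosses c₁ c₂ = (⌊ c₁ ≟ x ⌋ ∧ ⌊ c₂ ≟ y ⌋) ∨ (⌊ c₁ ≟ y ⌋ ∧ ⌊ c₂ ≟ x ⌋)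

    label : V × V → Fin (suc t)
    label ((r₁ , c₁) , (r₂ , c₂)) = if crosses c₁ c₂ then fsuc r₁ else fzero

    label-x→y : ∀ c → label ((c , x) , (c , y)) ≡ fsuc c
    label-x→y c rewrite ≟-refl x | ≟-refl y = refl

    label-y→x : ∀ c → label ((c , y) , (c , x)) ≡ fsuc c
    label-y→x c rewrite ≟-refl x | ≟-refl y | ∨-zeroʳ (⌊ y ≟ x ⌋ ∧ ⌊ x ≟ y ⌋) = refl

    label-other : ∀ {r₁ c₁ r₂ c₂} → ¬ (c₁ ≡ x × c₂ ≡ y) → ¬ (c₁ ≡ y × c₂ ≡ x) → label ((r₁ , c₁) , (r₂ , c₂)) ≡ fzero
    label-other ¬xy ¬yx rewrite both-≟-false ¬xy | both-≟-false ¬yx = refl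

    x<y : toℕ x < toℕ y
    x<y = ℕ.≤-reflexive (sym y≡x+1)

    first : Fin s
    first = fromℕ< (ℕ.≤-trans (s≤s z≤n) 3≤s)

    first≡0 : toℕ first ≡ 0
    first≡0 = Fin.toℕ-fromℕ< _

    last : Fin s
    last = prev first

    last≡s : suc (toℕ last) ≡ s
    last≡s with prev-spec first
    ... | inj₁ first≡suc      = ⊥-elim (ℕ.0≢1+n (trans (sym first≡0) first≡suc))
    ... | inj₂ (_ , last≡s) = last≡s

    below-x : RungsLabelled label fzero a first x
    below-x p q p≡q+1 _ p≤x = label-other {a} {p} {a} (λ (_ , q≡y) → q≢y q≡y) (λ (p≡y , _) → p≢y p≡y)
                            , label-other {a} {q} {a} (λ (_ , p≡y) → p≢y p≡y) (λ (q≡y , _) → q≢y q≡y)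
      where
      p≢y : p ≢ y
      p≢y p≡y = ℕ.<-irrefl (cong toℕ p≡y) (ℕ.≤-<-trans p≤x x<y)
      q≢y : q ≢ y
      q≢y q≡y = ℕ.<-irrefl (cong toℕ q≡y) (ℕ.<-trans (ℕ.<-≤-trans (ℕ.≤-reflexive (sym p≡q+1)) p≤x) x<y)

    above-y : RungsLabelled label fzero a y last
    above-y p q p≡q+1 y≤q _ = label-other {a} {p} {a} (λ (p≡x , _) → p≢x p≡x) (λ (_ , q≡x) → q≢x q≡x)
                            , label-other {a} {q} {a} (λ (q≡x , _) → q≢x q≡x) (λ (_ , p≡x) → p≢x p≡x)
      where
      q≢x : q ≢ x
      q≢x q≡x = ℕ.<-irrefl (sym (cong toℕ q≡x)) (ℕ.<-≤-trans x<y y≤q)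
      p≢x : p ≢ x
      p≢x p≡x = ℕ.<-irrefl (sym (cong toℕ p≡x)) (ℕ.<-trans (ℕ.<-≤-trans x<y y≤q) (ℕ.≤-reflexive (sym p≡q+1)))

    wrap-not-crossing : ¬ (first ≡ x × last ≡ y)
    wrap-not-crossing (first≡x , last≡y) =
      ℕ.<-irrefl (sym (trans (sym last≡s) (cong suc (trans (cong toℕ last≡y) (trans y≡x+1 (cong suc x≡0)))))) 3≤s
      where
      x≡0 : toℕ x ≡ 0
      x≡0 = trans (cong toℕ (sym first≡x)) first≡0

    first≢y : first ≢ y
    first≢y first≡y = ℕ.0≢1+n (trans (sym first≡0) (trans (cong toℕ first≡y) y≡x+1))

    long-way : Route label fzero (a , x) (a , y)
    long-way =
        descend a first (toℕ x) x (trans (sym (ℕ.+-identityʳ (toℕ x))) (cong (toℕ x +_) (sym first≡0))) below-x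
      ⟫ edge-route _ _ (H-row a first last (C-prev first))
          (label-other {a} {first} {a} wrap-not-crossing (λ (first≡y , _) → first≢y first≡y))
          (label-other {a} {last} {a} (λ (_ , first≡y) → first≢y first≡y)
                                      (λ (last≡y , first≡x) → wrap-not-crossing (first≡x , last≡y)))
      ⟫ descend a y (toℕ last ∸ toℕ y) last (sym (ℕ.m∸n+n≡m y≤last)) above-y
      where
      y≤last : toℕ y ≤ toℕ last
      y≤last = ℕ.s≤s⁻¹ (subst (toℕ y <_) (sym last≡s) (Fin.toℕ<n y))

    route : ∀ r → (∃[ c ] Walk G (a , x) (c , y)) ⊎ Blocked F label r
    route fzero with long-way
    ... | inj₁ walk    = inj₁ (a , walk)
    ... | inj₂ blocked = inj₂ blocked
    route (fsuc c) with edge-route (c , x) (c , y) (H-row c x y (C-step x y y≡x+1)) (label-x→y c) (label-y→x c)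
    ... | inj₁ rung    = inj₁ (c , column-walk a c x ++ʷ rung)
    ... | inj₂ blocked = inj₂ blocked

  next-column-walk : (a : Fin t) (x y : Fin s) → toℕ y ≡ suc (toℕ x) → ∃[ c ] Walk G (a , x) (c , y)
  next-column-walk a x y y≡x+1 = survivor (NextColumnRoutes.label a x y y≡x+1) (NextColumnRoutes.route a x y y≡x+1)

  walk-forward : ∀ d (a b : Fin t) (i j : Fin s) → toℕ j ≡ d + toℕ i → Walk G (a , i) (b , j)
  walk-forward zero    a b i j j≡i = subst (λ c → Walk G (a , i) (b , c)) (Fin.toℕ-injective (sym j≡i)) (column-walk a b i)
  walk-forward (suc d) a b i j j≡ =
    walk-forward d a b i j′ (Fin.toℕ-fromℕ< j′<s) ++ʷ proj₂ cross ++ʷ column-walk (proj₁ cross) b j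
    where
    j′<s : d + toℕ i < s
    j′<s = ℕ.<-trans (ℕ.n<1+n _) (subst (_< s) j≡ (Fin.toℕ<n j))
    j′ : Fin s
    j′ = fromℕ< j′<s
    cross : ∃[ c ] Walk G (b , j′) (c , j)
    cross = next-column-walk b j′ j (trans j≡ (cong suc (sym (Fin.toℕ-fromℕ< j′<s))))

  connected : Connected G
  connected (a , i) (b , j) with toℕ i ℕ.≤? toℕ j
  ... | yes i≤j = walk-forward (toℕ j ∸ toℕ i) a b i j (sym (ℕ.m∸n+n≡m i≤j))
  ... | no  i≰j = reverseʷ G-sym (walk-forward (toℕ i ∸ toℕ j) b a j i (sym (ℕ.m∸n+n≡m (ℕ.≰⇒≥ i≰j))))

⌊n/2⌋<m⇒n<m+m : ∀ n m → ⌊ n /2⌋ < m → n < m + m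
⌊n/2⌋<m⇒n<m+m n m half<m with n ℕ.<? m + m
... | yes n<2m = n<2m
... | no  n≮2m = ⊥-elim (ℕ.<⇒≱ half<m (ℕ.≤-trans (ℕ.≤-reflexive (ℕ.n≡⌊n+n/2⌋ m)) (ℕ.⌊n/2⌋-mono (ℕ.≮⇒≥ n≮2m))))

H-edgeConnectivity : 1 ≤ t → 3 ≤ s → EdgeConnectivity (vertices t s) (H t s) (t + 1)
H-edgeConnectivity {t} {s} 1≤t 3≤s =
  stays-connected , star z , star-spanning z , star-edgeCount 3≤s z , star-disconnects (ℕ.<⇒≤ 3≤s) z
  where
  z : Fin t × Fin s
  z = fromℕ< 1≤t , fromℕ< (ℕ.≤-trans (s≤s z≤n) 3≤s)
  stays-connected : (F : Graph (Fin t × Fin s)) → SpanningSubgraph (H t s) F →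
                    suc (edgeCount (vertices t s) F) ≤ t + 1 → Connected (H t s ∖ F)
  stays-connected F F-spanning few = FewEdgesDeleted.connected 3≤s F-spanning
    (subst (λ k → length (orderedPairs (vertices t s) F) < k + k) (ℕ.+-comm t 1) (⌊n/2⌋<m⇒n<m+m _ (t + 1) few))

-- Connectivity codes

MissesRungs : Graph (Fin t × Fin s) → Fin s → Set
MissesRungs D i = ∀ a → ¬ T (D (a , i) (a , next i))

-- The columns strictly after i and up to j form a union of components of D.
module RungCut {D : Graph (Fin t × Fin s)} (D-spanning : SpanningSubgraph (H t s) D)
               {i j : Fin s} (i<j : toℕ i < toℕ j) (misses-i : MissesRungs D i) (misses-j : MissesRungs D j) where

  InBand : Fin t × Fin s → Set
  InBand (_ , c) = toℕ i < toℕ c × toℕ c ≤ toℕ j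

  band-closed : ∀ x y → InBand x → T (D x y) → InBand y
  band-closed (a , c) (b , c′) (i<c , c≤j) d with H-cases a b c c′ (proj₂ D-spanning _ _ d)
  ... | inj₂ (refl , _) = i<c , c≤j
  ... | inj₁ (refl , rung) with C-neighbour c c′ rung
  ...   | inj₁ refl = ℕ.<-trans i<c (subst (toℕ c <_) (sym next≡) (ℕ.n<1+n _)) , subst (_≤ toℕ j) (sym next≡) c<j
    where
    c<j : toℕ c < toℕ j
    c<j = ℕ.≤∧≢⇒< c≤j (λ c≡j → misses-j a (subst (λ c → T (D (a , c) (a , next c))) (Fin.toℕ-injective c≡j) d))
    next≡ : toℕ (next c) ≡ suc (toℕ c)
    next≡ = toℕ-next c (ℕ.≤-<-trans c<j (Fin.toℕ<n j))
  ...   | inj₂ refl = ℕ.≤∧≢⇒< i≤prev (λ i≡prev → prev≢i (Fin.toℕ-injective (sym i≡prev)))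
                    , ℕ.≤-trans (ℕ.n≤1+n _) (subst (_≤ toℕ j) prev≡ c≤j)
    where
    prev≡ : toℕ c ≡ suc (toℕ (prev c))
    prev≡ with prev-spec c
    ... | inj₁ down     = down
    ... | inj₂ (c≡0 , _) = ⊥-elim (ℕ.n≮0 (subst (toℕ i <_) c≡0 i<c))
    i≤prev : toℕ i ≤ toℕ (prev c)
    i≤prev = ℕ.s≤s⁻¹ (subst (toℕ i <_) prev≡ i<c)
    prev≢i : prev c ≢ i
    prev≢i refl = misses-i a (subst (λ x → T (D (a , prev c) (a , x))) c≡next (subst T (proj₁ D-spanning _ _) d))
      where
      c≡next : c ≡ next (prev c)
      c≡next = Fin.toℕ-injective (trans prev≡ (sym (toℕ-next (prev c) (subst (_< _) prev≡ (Fin.toℕ<n c)))))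

  not-connected : 1 ≤ t → ¬ Connected D
  not-connected 1≤t connected =
    ℕ.<-irrefl refl (proj₁ (walk-preserves InBand band-closed (connected (a , next i) (a , i)) start))
    where
    a : Fin t
    a = fromℕ< 1≤t
    next≡ : toℕ (next i) ≡ suc (toℕ i)
    next≡ = toℕ-next i (ℕ.≤-<-trans i<j (Fin.toℕ<n j))
    start : InBand (a , next i)
    start = subst (toℕ i <_) (sym next≡) (ℕ.n<1+n _) , subst (_≤ toℕ j) (sym next≡) i<j

ascendingPairs : ℕ → List (ℕ × ℕ)
ascendingPairs zero    = []
ascendingPairs (suc n) = map (_, n) (upTo n) ++ ascendingPairs n

∈-ascendingPairs : ∀ {p q n} → p < q → q < n → (p , q) ∈ ascendingPairs n
∈-ascendingPairs {p} {q} {suc n} p<q q<1+n with q ℕ.≟ n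
... | yes refl = ∈-++⁺ˡ (∈-map⁺ (_, q) (∈-upTo⁺ p<q))
... | no  q≢n  = ∈-++⁺ʳ (map (_, n) (upTo n)) (∈-ascendingPairs p<q (ℕ.≤∧≢⇒< (ℕ.s≤s⁻¹ q<1+n) q≢n))

length-ascendingPairs : ∀ m → 2 * length (ascendingPairs (suc m)) ≡ suc m * m
length-ascendingPairs zero    = refl
length-ascendingPairs (suc m) = begin
  2 * length (map (_, suc m) (upTo (suc m)) ++ ascendingPairs (suc m))
    ≡⟨ cong (2 *_) (trans (List.length-++ (map (_, suc m) (upTo (suc m)))) (cong (_+ length (ascendingPairs (suc m))) row-length)) ⟩
  2 * (suc m + length (ascendingPairs (suc m)))        ≡⟨ ℕ.*-distribˡ-+ 2 (suc m) _ ⟩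
  2 * suc m + 2 * length (ascendingPairs (suc m))      ≡⟨ cong (2 * suc m +_) (length-ascendingPairs m) ⟩
  2 * suc m + suc m * m                                ≡⟨ expand m ⟩
  suc (suc m) * suc m                                  ∎
  where
  open ≡-Reasoning
  row-length : length (map (_, suc m) (upTo (suc m))) ≡ suc m
  row-length = trans (List.length-map _ (upTo (suc m))) (List.length-upTo (suc m))
  expand : ∀ m → 2 * suc m + suc m * m ≡ suc (suc m) * suc m
  expand = solve-∀

length-ascendingPairs-odd : ∀ h → length (ascendingPairs (suc (2 * h))) ≡ (2 * h + 1) * h
length-ascendingPairs-odd h = ℕ.*-cancelˡ-≡ _ _ 2 (begin
  2 * length (ascendingPairs (suc (2 * h))) ≡⟨ length-ascendingPairs (2 * h) ⟩
  suc (2 * h) * (2 * h)                     ≡⟨ regroup h ⟩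
  2 * ((2 * h + 1) * h)                     ∎)
  where
  open ≡-Reasoning
  regroup : ∀ h → suc (2 * h) * (2 * h) ≡ 2 * ((2 * h + 1) * h)
  regroup = solve-∀

AgreeOnRungs : Graph (Fin t × Fin s) → Graph (Fin t × Fin s) → Fin s → Set
AgreeOnRungs G G′ i = ∀ a → G (a , i) (a , next i) ≡ G′ (a , i) (a , next i)

⊕-misses-rungs : (G G′ : Graph (Fin t × Fin s)) {i : Fin s} → AgreeOnRungs G G′ i → MissesRungs (G ⊕ G′) i
⊕-misses-rungs G G′ {i} agree a =
  subst T (trans (cong (_xor G′ (a , i) (a , next i)) (agree a)) (xor-same (G′ (a , i) (a , next i))))

rungs-code : Graph (Fin t × Fin s) → Fin s → Fin (2 ^ t)
rungs-code G i = funToFin (λ a → Inverse.from Fin.2↔Bool (G (a , i) (a , next i)))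

rungs-code-decode : (G : Graph (Fin t × Fin s)) (i : Fin s) (a : Fin t) →
                    Inverse.to Fin.2↔Bool (Fin.finToFun (rungs-code G i) a) ≡ G (a , i) (a , next i)
rungs-code-decode G i a =
  trans (cong (Inverse.to Fin.2↔Bool) (Fin.finToFun-funToFin _ a)) (Inverse.strictlyInverseˡ Fin.2↔Bool _)

rungs-code-injective : (G G′ : Graph (Fin t × Fin s)) (i : Fin s) → rungs-code G i ≡ rungs-code G′ i → AgreeOnRungs G G′ i
rungs-code-injective G G′ i same a =
  trans (sym (rungs-code-decode G i a))
        (trans (cong (λ k → Inverse.to Fin.2↔Bool (Fin.finToFun k a)) same) (rungs-code-decode G′ i a))

rung-collision : (Gs : Fin (suc (2 ^ t)) → Graph (Fin t × Fin s)) (i : Fin s) →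
                 ∃₂ λ lo hi → lo Fin.< hi × AgreeOnRungs (Gs lo) (Gs hi) i
rung-collision {t} Gs i =
  let lo , hi , lo<hi , same = Fin.pigeonhole (ℕ.n<1+n (2 ^ t)) (λ k → rungs-code (Gs k) i)
  in lo , hi , lo<hi , rungs-code-injective (Gs lo) (Gs hi) i same

double-collision : (Gs : Fin (suc (2 ^ t)) → Graph (Fin t × Fin s)) → length (ascendingPairs (suc (2 ^ t))) < s →
                   ∃₂ λ lo hi → lo Fin.< hi ×
                   ∃₂ λ i j → toℕ i < toℕ j × AgreeOnRungs (Gs lo) (Gs hi) i × AgreeOnRungs (Gs lo) (Gs hi) j
double-collision {t} {s} Gs few-pairs =
  let i , j , i<j , same = pigeonhole-∈ (ascendingPairs (suc (2 ^ t))) pair pair∈ few-pairs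
      lo≡ = Fin.toℕ-injective (cong proj₁ same)
      hi≡ = Fin.toℕ-injective (cong proj₂ same)
  in lo i , hi i , lo<hi i , i , j , i<j , agree i
   , subst₂ (λ l h → AgreeOnRungs (Gs l) (Gs h) j) (sym lo≡) (sym hi≡) (agree j)
  where
  lo hi : Fin s → Fin (suc (2 ^ t))
  lo i = proj₁ (rung-collision Gs i)
  hi i = proj₁ (proj₂ (rung-collision Gs i))
  lo<hi : ∀ i → lo i Fin.< hi i
  lo<hi i = proj₁ (proj₂ (proj₂ (rung-collision Gs i)))
  agree : ∀ i → AgreeOnRungs (Gs (lo i)) (Gs (hi i)) i
  agree i = proj₂ (proj₂ (proj₂ (rung-collision Gs i)))
  pair : Fin s → ℕ × ℕ
  pair i = toℕ (lo i) , toℕ (hi i)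
  pair∈ : ∀ i → pair i ∈ ascendingPairs (suc (2 ^ t))
  pair∈ i = ∈-ascendingPairs (lo<hi i) (Fin.toℕ<n (hi i))

⊕-spanning : {V : Set} {H₀ G G′ : Graph V} → SpanningSubgraph H₀ G → SpanningSubgraph H₀ G′ → SpanningSubgraph H₀ (G ⊕ G′)
⊕-spanning {H₀ = H₀} {G} {G′} (G-sym , G⊆H) (G′-sym , G′⊆H) =
  (λ u v → cong₂ _xor_ (G-sym u v) (G′-sym u v)) , ⊆H
  where
  ⊆H : ∀ u v → T ((G ⊕ G′) u v) → T (H₀ u v)
  ⊆H u v p with G u v in Guv
  ... | true  = G⊆H u v (subst T (sym Guv) tt)
  ... | false = G′⊆H u v p

code-bound : 1 ≤ t → length (ascendingPairs (suc (2 ^ t))) < s →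
             (𝒢 : ConnectivityCode (H t s)) → length (members 𝒢) ≤ 2 ^ t
code-bound {t} {s} 1≤t few-pairs 𝒢 = ℕ.≮⇒≥ too-large
  where
  member : 2 ^ t < length (members 𝒢) → Fin (suc (2 ^ t)) → Graph (Fin t × Fin s)
  member large k = lookup (members 𝒢) (Fin.inject≤ k large)

  too-large : ¬ (2 ^ t < length (members 𝒢))
  too-large large with double-collision (member large) few-pairs
  ... | lo , hi , lo<hi , i , j , i<j , agree-i , agree-j =
    RungCut.not-connected (⊕-spanning (spanning 𝒢 _) (spanning 𝒢 _)) i<j
      (⊕-misses-rungs (member large lo) (member large hi) agree-i)
      (⊕-misses-rungs (member large lo) (member large hi) agree-j) 1≤t
      (pairwise 𝒢 _ _ (λ same → Fin.<-irrefl (Fin.inject≤-injective large large lo hi same) lo<hi))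

proposition3p2 : (t s : ℕ) → 1 ≤ t → 3 ≤ s → (2 ^ t + 1) * 2 ^ (t ∸ 1) < s →
    Regular (vertices t s) (H t s) (t + 1)
    × EdgeConnectivity (vertices t s) (H t s) (t + 1)
    × ((𝒢 : ConnectivityCode (H t s)) → length (members 𝒢) ≤ 2 ^ t)
proposition3p2 (suc t′) s 1≤t 3≤s s-large =
    H-regular 3≤s
  , H-edgeConnectivity 1≤t 3≤s
  , code-bound 1≤t (subst (_< s) (sym (length-ascendingPairs-odd (2 ^ t′))) s-large)
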